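{- Let $m\ge 3$ and $n\ge 5$ be integers and let $P_n$ be the path on $n$ vertices. Then ${\rm im}(\mu_m(P_n))=5$.
   Context: For graphs $G$ and $H$, $G$ has an $H$-immersion if there is a one-to-one map $\phi:V(H)\to V(G)$ such that for each edge $uv\in E(H)$ there is a path $P_{uv}$ in $G$ joining $\phi(u)$ and $\phi(v)$, with the paths $P_{uv}$ pairwise edge-disjoint. The immersion number ${\rm im}(G)$ is the largest $t$ such that $G$ has a $K_t$-immersion. For an integer $m\ge1$, the $m$-Mycielskian $\mu_m(G)$ is the graph with vertex set $(V(G)\times\{0,1,\dots,m-1\})\cup\{w\}$ and edges $(u,0)(v,0)$ and $(u,i)(v,i+1)$ for all $uv\in E(G)$ (with $(u,i)(v,i+1)$ for $0\le i\le m-2$, in both orientations of $uv$), together with edges $(u,m-1)w$ for all $u\in V(G)$. -}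

module Defs where

open import Data.Nat using (ℕ; zero; suc; _≤_; _<_)
open import Data.Fin using (Fin; toℕ)
open import Data.List using (List; []; _∷_)
open import Data.List.Relation.Unary.Unique.Propositional using (Unique)
open import Data.Product using (_×_; Σ-syntax)
open import Data.Sum using (_⊎_)
open import Function.Definitions using (Injective)
open import Relation.Binary.PropositionalEquality using (_≡_)

record Graph : Set₁ where
  field
    V   : Set
    Adj : V → V → Set
open Graph public

data PathAdj {n : ℕ} : Fin n → Fin n → Set where
  fwd : ∀ {i j} → suc (toℕ i) ≡ toℕ j → PathAdj i j
  bwd : ∀ {i j} → toℕ i ≡ suc (toℕ j) → PathAdj i j

P : ℕ → Graph
P n = record { V = Fin n ; Adj = PathAdj }

-- m-Mycielskian.  Vertex (u , i) is  vtx u i ; the apex is w.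
data MV (A : Set) (m : ℕ) : Set where
  vtx : A → Fin m → MV A m
  w   : MV A m

data MAdj (G : Graph) (m : ℕ) : MV (V G) m → MV (V G) m → Set where
  lvl0 : ∀ {u v} {i j : Fin m} → Adj G u v → toℕ i ≡ 0 → toℕ j ≡ 0 →
         MAdj G m (vtx u i) (vtx v j)
  -- (u,i)(v,i+1), listed in both directions of the (undirected) edge
  up   : ∀ {u v} {i j : Fin m} → Adj G u v → suc (toℕ i) ≡ toℕ j →
         MAdj G m (vtx u i) (vtx v j)
  down : ∀ {u v} {i j : Fin m} → Adj G u v → toℕ i ≡ suc (toℕ j) →
         MAdj G m (vtx u i) (vtx v j)
  toW   : ∀ {u} {i : Fin m} → suc (toℕ i) ≡ m → MAdj G m (vtx u i) w
  fromW : ∀ {u} {i : Fin m} → suc (toℕ i) ≡ m → MAdj G m w (vtx u i)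

μ : ℕ → Graph → Graph
μ m G = record { V = MV (V G) m ; Adj = MAdj G m }

data Walk (G : Graph) : V G → V G → Set where
  []  : ∀ {x} → Walk G x x
  _∷_ : ∀ {x y z} → Adj G x y → Walk G y z → Walk G x z

vertices : ∀ {G x y} → Walk G x y → List (V G)
vertices {x = x} [] = x ∷ []
vertices {x = x} (_ ∷ p) = x ∷ vertices p

data UsesEdge {G : Graph} : ∀ {x y} → Walk G x y → V G → V G → Set where
  here  : ∀ {x y z} (e : Adj G x y) (p : Walk G y z) {a b} →
          (a ≡ x × b ≡ y) ⊎ (a ≡ y × b ≡ x) → UsesEdge (e ∷ p) a b
  there : ∀ {x y z} (e : Adj G x y) (p : Walk G y z) {a b} →
          UsesEdge p a b → UsesEdge (e ∷ p) a b

IsPath : ∀ {G x y} → Walk G x y → Set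
IsPath p = Unique (vertices p)

record Immersion (G : Graph) (t : ℕ) : Set where
  field
    φ     : Fin t → V G
    φ-inj : Injective _≡_ _≡_ φ
    path  : (i j : Fin t) → i Data.Fin.< j → Walk G (φ i) (φ j)
    path-isPath : ∀ i j (i<j : i Data.Fin.< j) → IsPath (path i j i<j)
    edge-disjoint : ∀ i j k l (i<j : i Data.Fin.< j) (k<l : k Data.Fin.< l) a b →
      UsesEdge (path i j i<j) a b → UsesEdge (path k l k<l) a b →
      i ≡ k × j ≡ l

ImNumberIs : Graph → ℕ → Set
ImNumberIs G t = Immersion G t × (∀ s → Immersion G s → s ≤ t)

-- Away from the apex w every vertex (u, i) of μ_m(P_n) has degree at most 4: its neighbours are
-- (u ± 1, i ± 1), or (u ± 1, 0) when i = 0, or w. A branch vertex of a K_t-immersion starts t − 1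
-- edge-disjoint paths, so it has degree at least t − 1; for t ≥ 6 two distinct branch vertices would
-- both have to be w.
--
-- For K_5 take the branch vertices (1,0), (1,1), (2,0), (3,0), (3,1). Eight of the ten pairs are joined
-- by paths of length at most 2 on levels 0–2. The pairs {(1,0),(3,1)} and {(1,1),(3,0)} are joined through
-- w: each path zigzags up between columns 0 and 1 and down between columns 3 and 4, and the two paths use
-- opposite phases of these zigzags, so they never share an edge. Edge-disjointness is certified by an
-- owner function: every edge gets at most one pair, and every edge of the path joining i and j gets (i, j).

module Submission where

open import Defs
open import Data.Bool using (if_then_else_; _∨_)
open import Data.Empty using (⊥-elim)
open import Data.Fin as Fin using (Fin; toℕ; fromℕ<; punchIn; join; splitAt)
open import Data.Fin.Patterns using (0F; 1F; 2F; 3F; 4F)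
open import Data.Fin.Properties
  using (toℕ-injective; toℕ<n; toℕ-fromℕ<; splitAt-join; <-cmp; punchIn-injective; punchInᵢ≢i; injective⇒≤)
  renaming (_≟_ to _≟ᶠ_)
open import Data.List using (List; []; _∷_; _++_)
open import Data.List.Membership.Propositional using (_∈_)
import Data.List.Membership.DecPropositional as DecMembership
open import Data.List.Relation.Unary.All using ([]; _∷_)
open import Data.List.Relation.Unary.All.Properties using (¬Any⇒All¬)
open import Data.List.Relation.Unary.AllPairs using ([]; _∷_)
open import Data.List.Relation.Unary.Any using (here; there)
open import Data.Maybe using (Maybe; just; nothing)
open import Data.Maybe.Properties using (just-injective)
open import Data.Nat using (ℕ; zero; suc; _+_; _≤_; _<_; _≥_; s≤s; z≤n; parity)
open import Data.Nat.Properties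
  using (suc-injective; <-irrefl; +-suc; +-identityʳ; m≤m+n; ≤-trans; ≤-reflexive; n≤1+n)
open import Data.Parity using (Parity; 0ℙ; 1ℙ; _⁻¹)
open import Data.Parity.Properties using (suc-homo-⁻¹)
open import Data.Product using (Σ-syntax; _×_; _,_; proj₁; proj₂)
open import Data.Product.Properties using (,-injectiveˡ; ,-injectiveʳ) renaming (≡-dec to ×-≡-dec)
open import Data.Sum using (_⊎_; inj₁; inj₂; swap)
open import Data.Sum.Properties using (inj₁-injective; inj₂-injective)
open import Function using (_∘_)
open import Function.Definitions using (Injective)
open import Relation.Binary.Definitions using (DecidableEquality; tri<; tri≈; tri>)
open import Relation.Binary.PropositionalEquality using (_≡_; refl; sym; trans; cong; cong₂; subst)
open import Relation.Nullary using (yes; no; does; ¬_)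

module _ {G : Graph} where

  infixr 5 _++ʷ_

  _++ʷ_ : ∀ {x y z} → Walk G x y → Walk G y z → Walk G x z
  [] ++ʷ q = q
  (e ∷ p) ++ʷ q = e ∷ (p ++ʷ q)

  _⊆ᵉ_ : ∀ {x y x′ y′} → Walk G x y → Walk G x′ y′ → Set
  p ⊆ᵉ q = ∀ {a b} → UsesEdge p a b → UsesEdge q a b

  UsesEdge-++ : ∀ {x y z} (p : Walk G x y) (q : Walk G y z) {a b} →
                UsesEdge (p ++ʷ q) a b → UsesEdge p a b ⊎ UsesEdge q a b
  UsesEdge-++ [] q u = inj₂ u
  UsesEdge-++ (e ∷ p) q (here _ _ h) = inj₁ (here e p h)
  UsesEdge-++ (e ∷ p) q (there _ _ u) with UsesEdge-++ p q u
  ... | inj₁ v = inj₁ (there e p v)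
  ... | inj₂ v = inj₂ v

  first-edge : ∀ {x z} → ¬ x ≡ z → (p : Walk G x z) → Σ[ y ∈ V G ] Adj G x y × UsesEdge p x y
  first-edge x≢z [] = ⊥-elim (x≢z refl)
  first-edge x≢z (e ∷ p) = _ , e , here e p (inj₁ (refl , refl))

  module _ (sym-adj : ∀ {x y} → Adj G x y → Adj G y x) where

    reverse : ∀ {x y} → Walk G x y → Walk G y x
    reverse [] = []
    reverse (e ∷ p) = reverse p ++ʷ (sym-adj e ∷ [])

    reverse-⊆ᵉ : ∀ {x y} (p : Walk G x y) → reverse p ⊆ᵉ p
    reverse-⊆ᵉ (e ∷ p) u with UsesEdge-++ (reverse p) (sym-adj e ∷ []) u
    ... | inj₁ v = there e p (reverse-⊆ᵉ p v)
    ... | inj₂ (here _ _ h) = here e p (swap h)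
    ... | inj₂ (there _ _ ())

    last-edge : ∀ {x z} → ¬ z ≡ x → (p : Walk G z x) → Σ[ y ∈ V G ] Adj G x y × UsesEdge p x y
    last-edge z≢x [] = ⊥-elim (z≢x refl)
    last-edge z≢x (e ∷ p) = go e p
      where
        go : ∀ {z y x} (e : Adj G z y) (p : Walk G y x) → Σ[ y′ ∈ V G ] Adj G x y′ × UsesEdge (e ∷ p) x y′
        go e [] = _ , sym-adj e , here e [] (inj₂ (refl , refl))
        go e (e′ ∷ p) with go e′ p
        ... | y , e″ , u = y , e″ , there e _ u

  module _ (_≟_ : DecidableEquality (V G)) where
    open DecMembership _≟_ using (_∈?_)

    suffix : ∀ {x y z} (p : Walk G x y) → z ∈ vertices p → IsPath p →
             Σ[ q ∈ Walk G z y ] IsPath q × q ⊆ᵉ p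
    suffix [] (here refl) p-path = [] , p-path , λ u → u
    suffix (e ∷ p) (here refl) p-path = e ∷ p , p-path , λ u → u
    suffix (e ∷ p) (there z∈p) (_ ∷ p-path) with suffix p z∈p p-path
    ... | q , q-path , q⊆p = q , q-path , λ u → there e p (q⊆p u)

    walk⇒path : ∀ {x y} (p : Walk G x y) → Σ[ q ∈ Walk G x y ] IsPath q × q ⊆ᵉ p
    walk⇒path [] = [] , [] ∷ [] , λ u → u
    walk⇒path {x} (e ∷ p) with walk⇒path p
    ... | q , q-path , q⊆p with x ∈? vertices q
    ...   | yes x∈q with suffix q x∈q q-path
    ...     | r , r-path , r⊆q = r , r-path , λ u → there e p (q⊆p (r⊆q u))
    walk⇒path {x} (e ∷ p) | q , q-path , q⊆p | no x∉q =
      e ∷ q , ¬Any⇒All¬ (vertices q) x∉q ∷ q-path ,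
      λ { (here _ _ h) → here e p h ; (there _ _ u) → there e p (q⊆p u) }

edges : ∀ {G x y} → Walk G x y → List (V G × V G)
edges [] = []
edges {x = x} (_∷_ {y = y} _ p) = (x , y) ∷ edges p

record DegreeAtMost (G : Graph) (d : ℕ) (x : V G) : Set where
  field
    code : ∀ {y} → Adj G x y → Fin d
    code-injective : ∀ {y y′} (e : Adj G x y) (e′ : Adj G x y′) → code e ≡ code e′ → y ≡ y′

module _ {G : Graph} (sym-adj : ∀ {x y} → Adj G x y → Adj G y x) {t : ℕ} (I : Immersion G (suc t)) where
  open Immersion I

  record Exit (i j : Fin (suc t)) : Set where
    field
      {target} : V G
      edge : Adj G (φ i) target
      {start end} : Fin (suc t)
      start<end : start Fin.< end
      on-path : UsesEdge (path start end start<end) (φ i) target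
      joins : (start ≡ i × end ≡ j) ⊎ (start ≡ j × end ≡ i)

  exit : ∀ {i j} → ¬ i ≡ j → Exit i j
  exit {i} {j} i≢j with <-cmp i j
  ... | tri< i<j _ _ with first-edge (i≢j ∘ φ-inj) (path i j i<j)
  ...   | _ , e , u = record { edge = e ; start<end = i<j ; on-path = u ; joins = inj₁ (refl , refl) }
  exit i≢j | tri≈ _ i≡j _ = ⊥-elim (i≢j i≡j)
  exit {i} {j} i≢j | tri> _ _ j<i with last-edge sym-adj (i≢j ∘ sym ∘ φ-inj) (path j i j<i)
  ...   | _ , e , u = record { edge = e ; start<end = j<i ; on-path = u ; joins = inj₂ (refl , refl) }

  exit-injective : ∀ {i j j′} → ¬ i ≡ j → ¬ i ≡ j′ → (x : Exit i j) (x′ : Exit i j′) →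
                   Exit.target x ≡ Exit.target x′ → j ≡ j′
  exit-injective i≢j i≢j′ x x′ refl
    with edge-disjoint _ _ _ _ (Exit.start<end x) (Exit.start<end x′) _ _ (Exit.on-path x) (Exit.on-path x′)
       | Exit.joins x | Exit.joins x′
  ... | refl , refl | inj₁ (refl , refl) | inj₁ (_ , refl) = refl
  ... | refl , refl | inj₁ (refl , refl) | inj₂ (refl , _) = ⊥-elim (i≢j′ refl)
  ... | refl , refl | inj₂ (refl , refl) | inj₁ (refl , _) = ⊥-elim (i≢j refl)
  ... | refl , refl | inj₂ (refl , refl) | inj₂ (refl , _) = refl

  branch-degree : ∀ {d} i → DegreeAtMost G d (φ i) → t ≤ d
  branch-degree i deg = injective⇒≤ code∘exit-injective
    where
      open DegreeAtMost deg
      i≢punchIn : ∀ j → ¬ i ≡ punchIn i j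
      i≢punchIn j = punchInᵢ≢i i j ∘ sym
      exit-to : ∀ j → Exit i (punchIn i j)
      exit-to j = exit (i≢punchIn j)
      code∘exit-injective : Injective _≡_ _≡_ (λ j → code (Exit.edge (exit-to j)))
      code∘exit-injective {j} {j′} eq = punchIn-injective i j j′
        (exit-injective (i≢punchIn j) (i≢punchIn j′) (exit-to j) (exit-to j′)
          (code-injective (Exit.edge (exit-to j)) (Exit.edge (exit-to j′)) eq))

-- The upper bound

P-sym : ∀ {n} {u v : Fin n} → PathAdj u v → PathAdj v u
P-sym (fwd e) = bwd (sym e)
P-sym (bwd e) = fwd (sym e)

μ-sym : ∀ {G m} → (∀ {u v} → Adj G u v → Adj G v u) → ∀ {x y} → MAdj G m x y → MAdj G m y x
μ-sym sym-adj (lvl0 e i≡0 j≡0) = lvl0 (sym-adj e) j≡0 i≡0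
μ-sym sym-adj (up e eq) = down (sym-adj e) (sym eq)
μ-sym sym-adj (down e eq) = up (sym-adj e) (sym eq)
μ-sym sym-adj (toW eq) = fromW eq
μ-sym sym-adj (fromW eq) = toW eq

P-degree : ∀ {n} (u : Fin n) → DegreeAtMost (P n) 2 u
P-degree u = record { code = code ; code-injective = code-injective }
  where
    code : ∀ {v} → PathAdj u v → Fin 2
    code (fwd _) = 0F
    code (bwd _) = 1F
    code-injective : ∀ {v v′} (e : PathAdj u v) (e′ : PathAdj u v′) → code e ≡ code e′ → v ≡ v′
    code-injective (fwd e) (fwd e′) _ = toℕ-injective (trans (sym e) e′)
    code-injective (bwd e) (bwd e′) _ = toℕ-injective (suc-injective (trans (sym e) e′))

join-injective : ∀ m n {x y : Fin m ⊎ Fin n} → join m n x ≡ join m n y → x ≡ y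
join-injective m n {x} {y} eq =
  trans (sym (splitAt-join m n x)) (trans (cong (splitAt m) eq) (splitAt-join m n y))

μ-vtx-degree : ∀ {G d m} → (∀ u → DegreeAtMost G (suc d) u) →
               ∀ u (i : Fin m) → DegreeAtMost (μ m G) (suc d + suc d) (vtx u i)
μ-vtx-degree {G} {d} {m} deg u i = record
  { code = λ e → join (suc d) (suc d) (code e)
  ; code-injective = λ e e′ eq → code-injective e e′ (join-injective (suc d) (suc d) eq)
  }
  where
    open DegreeAtMost (deg u) renaming (code to codeᴳ; code-injective to codeᴳ-injective)
    code : ∀ {y} → MAdj G m (vtx u i) y → Fin (suc d) ⊎ Fin (suc d)
    code (lvl0 e _ _) = inj₁ (codeᴳ e)
    code (down e _) = inj₁ (codeᴳ e)
    code (up e _) = inj₂ (codeᴳ e)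
    code (toW _) = inj₂ 0F
    code-injective : ∀ {y y′} (e : MAdj G m (vtx u i) y) (e′ : MAdj G m (vtx u i) y′) →
                     code e ≡ code e′ → y ≡ y′
    code-injective (lvl0 e _ j≡0) (lvl0 e′ _ j′≡0) eq =
      cong₂ vtx (codeᴳ-injective e e′ (inj₁-injective eq)) (toℕ-injective (trans j≡0 (sym j′≡0)))
    code-injective (lvl0 _ i≡0 _) (down _ i≡1+j) _ with () ← trans (sym i≡0) i≡1+j
    code-injective (down _ i≡1+j) (lvl0 _ i≡0 _) _ with () ← trans (sym i≡0) i≡1+j
    code-injective (down e i≡1+j) (down e′ i≡1+j′) eq =
      cong₂ vtx (codeᴳ-injective e e′ (inj₁-injective eq))
                (toℕ-injective (suc-injective (trans (sym i≡1+j) i≡1+j′)))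
    code-injective (up e 1+i≡j) (up e′ 1+i≡j′) eq =
      cong₂ vtx (codeᴳ-injective e e′ (inj₂-injective eq)) (toℕ-injective (trans (sym 1+i≡j) 1+i≡j′))
    code-injective (up _ 1+i≡j) (toW 1+i≡m) _ = ⊥-elim (<-irrefl (trans (sym 1+i≡j) 1+i≡m) (toℕ<n _))
    code-injective (toW 1+i≡m) (up _ 1+i≡j) _ = ⊥-elim (<-irrefl (trans (sym 1+i≡j) 1+i≡m) (toℕ<n _))
    code-injective (toW _) (toW _) _ = refl

non-apex-branch : ∀ {G m t} (I : Immersion (μ m G) (suc (suc t))) →
                  Σ[ i ∈ Fin (suc (suc t)) ] Σ[ u ∈ V G ] Σ[ a ∈ Fin m ] Immersion.φ I i ≡ vtx u a
non-apex-branch I with Immersion.φ I 0F in φ₀ | Immersion.φ I 1F in φ₁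
... | vtx u a | _ = 0F , u , a , φ₀
... | w | vtx u a = 1F , u , a , φ₁
... | w | w with () ← Immersion.φ-inj I (trans φ₀ (sym φ₁))

μP-immersion-size : ∀ {m n t} → Immersion (μ m (P n)) t → t ≤ 5
μP-immersion-size {t = zero} _ = z≤n
μP-immersion-size {t = suc zero} _ = s≤s z≤n
μP-immersion-size {t = suc (suc t)} I with non-apex-branch I
... | i , u , a , φi≡ua =
  s≤s (branch-degree (μ-sym P-sym) I i (subst (DegreeAtMost _ 4) (sym φi≡ua) (μ-vtx-degree P-degree u a)))

-- The lower bound

MV-≡-dec : ∀ {A m} → DecidableEquality A → DecidableEquality (MV A m)
MV-≡-dec _≟_ (vtx u i) (vtx v j) with u ≟ v | i ≟ᶠ j
... | yes refl | yes refl = yes refl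
... | no u≢v | _ = no λ { refl → u≢v refl }
... | yes _ | no i≢j = no λ { refl → i≢j refl }
MV-≡-dec _≟_ (vtx _ _) w = no λ ()
MV-≡-dec _≟_ w (vtx _ _) = no λ ()
MV-≡-dec _≟_ w w = yes refl

-- M and N stand for m and n, written so that levels 0–2 and columns 0–4 are constructor patterns.
module Construction (k l : ℕ) where
  M N : ℕ
  M = 3 + k
  N = 5 + l

  G : Graph
  G = μ M (P N)

  Vertex : Set
  Vertex = MV (Fin N) M

  _≟_ : DecidableEquality Vertex
  _≟_ = MV-≡-dec _≟ᶠ_

  Label : Set
  Label = Fin 5 × Fin 5

  branch : Fin 5 → Vertex
  branch 0F = vtx 1F 0F
  branch 1F = vtx 1F 1F
  branch 2F = vtx 2F 0F
  branch 3F = vtx 3F 0F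
  branch 4F = vtx 3F 1F

  branch-index : Vertex → Fin 5
  branch-index (vtx 1F 1F) = 1F
  branch-index (vtx 2F 0F) = 2F
  branch-index (vtx 3F 0F) = 3F
  branch-index (vtx 3F 1F) = 4F
  branch-index _ = 0F

  branch-injective : ∀ {i j} → branch i ≡ branch j → i ≡ j
  branch-injective {i} {j} eq = trans (sym (index∘branch i)) (trans (cong branch-index eq) (index∘branch j))
    where
      index∘branch : ∀ i → branch-index (branch i) ≡ i
      index∘branch 0F = refl
      index∘branch 1F = refl
      index∘branch 2F = refl
      index∘branch 3F = refl
      index∘branch 4F = refl

  route₀₁ : Walk G (branch 0F) (branch 1F)
  route₀₁ = lvl0 (bwd refl) refl refl ∷ up (fwd refl) refl ∷ []
  route₀₂ : Walk G (branch 0F) (branch 2F)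
  route₀₂ = lvl0 (fwd refl) refl refl ∷ []
  route₀₃ : Walk G (branch 0F) (branch 3F)
  route₀₃ = up (fwd refl) refl ∷ down (fwd refl) refl ∷ []
  route₁₂ : Walk G (branch 1F) (branch 2F)
  route₁₂ = down (fwd refl) refl ∷ []
  route₁₄ : Walk G (branch 1F) (branch 4F)
  route₁₄ = up (fwd refl) refl ∷ down (fwd refl) refl ∷ []
  route₂₃ : Walk G (branch 2F) (branch 3F)
  route₂₃ = lvl0 (fwd refl) refl refl ∷ []
  route₂₄ : Walk G (branch 2F) (branch 4F)
  route₂₄ = up (fwd refl) refl ∷ []
  route₃₄ : Walk G (branch 3F) (branch 4F)
  route₃₄ = lvl0 (fwd refl) refl refl ∷ up (bwd refl) refl ∷ []

  ramp₀₄ : Walk G (branch 0F) (vtx 1F 2F)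
  ramp₀₄ = up (bwd refl) refl ∷ up (fwd refl) refl ∷ []
  ramp₄₀ : Walk G (vtx 4F 2F) (branch 4F)
  ramp₄₀ = down (bwd refl) refl ∷ []
  ramp₁₃ : Walk G (branch 1F) (vtx 0F 2F)
  ramp₁₃ = up (bwd refl) refl ∷ []
  ramp₃₁ : Walk G (vtx 3F 2F) (branch 3F)
  ramp₃₁ = down (fwd refl) refl ∷ down (bwd refl) refl ∷ []

  low-segments : List (Label × List (Vertex × Vertex))
  low-segments =
    ((0F , 1F) , edges route₀₁) ∷ ((0F , 2F) , edges route₀₂) ∷ ((0F , 3F) , edges route₀₃) ∷
    ((1F , 2F) , edges route₁₂) ∷ ((1F , 4F) , edges route₁₄) ∷ ((2F , 3F) , edges route₂₃) ∷
    ((2F , 4F) , edges route₂₄) ∷ ((3F , 4F) , edges route₃₄) ∷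
    ((0F , 4F) , edges ramp₀₄ ++ edges ramp₄₀) ∷ ((1F , 3F) , edges ramp₁₃ ++ edges ramp₃₁) ∷ []

  open DecMembership (×-≡-dec _≟_ _≟_) using (_∈?_)

  -- The owner of a low edge is read off the segments themselves: the refl proofs in route below
  -- check that no edge is listed in two segments.
  low-owner : Vertex → Vertex → List (Label × List (Vertex × Vertex)) → Maybe Label
  low-owner a b [] = nothing
  low-owner a b ((ℓ , es) ∷ segments) =
    if does ((a , b) ∈? es) ∨ does ((b , a) ∈? es) then just ℓ else low-owner a b segments

  rung-owner : Fin N → Parity → Maybe Label
  rung-owner 1F 0ℙ = just (0F , 4F)
  rung-owner 0F 1ℙ = just (0F , 4F)
  rung-owner 4F 0ℙ = just (0F , 4F)
  rung-owner 3F 1ℙ = just (0F , 4F)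
  rung-owner 0F 0ℙ = just (1F , 3F)
  rung-owner 1F 1ℙ = just (1F , 3F)
  rung-owner 3F 0ℙ = just (1F , 3F)
  rung-owner 4F 1ℙ = just (1F , 3F)
  rung-owner _ _ = nothing

  -- An edge between levels ≥ 2 (or w) can only lie on a zigzag, and both of its ends have the same
  -- rung-owner, so the owner may be read off whichever end is not w.
  owner : Vertex → Vertex → Maybe Label
  owner (vtx u i@(Fin.suc (Fin.suc _))) (vtx _ (Fin.suc (Fin.suc _))) = rung-owner u (parity (toℕ i))
  owner (vtx u i@(Fin.suc (Fin.suc _))) w = rung-owner u (parity (toℕ i))
  owner w (vtx u i@(Fin.suc (Fin.suc _))) = rung-owner u (parity (toℕ i))
  owner a b = low-owner a b low-segments

  Labelled : Label → ∀ {x y} → Walk G x y → Set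
  Labelled ℓ p = ∀ {a b} → UsesEdge p a b → owner a b ≡ just ℓ

  Labelled-[] : ∀ {ℓ x} → Labelled ℓ ([] {x = x})
  Labelled-[] ()

  Labelled-∷ : ∀ {ℓ x y z} {e : Adj G x y} {p : Walk G y z} →
               owner x y ≡ just ℓ → owner y x ≡ just ℓ → Labelled ℓ p → Labelled ℓ (e ∷ p)
  Labelled-∷ xy yx p-labelled (here _ _ (inj₁ (refl , refl))) = xy
  Labelled-∷ xy yx p-labelled (here _ _ (inj₂ (refl , refl))) = yx
  Labelled-∷ xy yx p-labelled (there _ _ u) = p-labelled u

  Labelled-++ : ∀ {ℓ x y z} {p : Walk G x y} {q : Walk G y z} →
                Labelled ℓ p → Labelled ℓ q → Labelled ℓ (p ++ʷ q)
  Labelled-++ {p = p} {q} p-labelled q-labelled u with UsesEdge-++ p q u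
  ... | inj₁ v = p-labelled v
  ... | inj₂ v = q-labelled v

  Labelled-⊆ᵉ : ∀ {ℓ x y x′ y′} {p : Walk G x y} {q : Walk G x′ y′} → q ⊆ᵉ p → Labelled ℓ p → Labelled ℓ q
  Labelled-⊆ᵉ q⊆p p-labelled u = p-labelled (q⊆p u)

  owner-up : ∀ {u v} {i j : Fin M} → 2 ≤ toℕ i → 2 ≤ toℕ j →
             owner (vtx u i) (vtx v j) ≡ rung-owner u (parity (toℕ i))
  owner-up {i = Fin.suc (Fin.suc _)} {Fin.suc (Fin.suc _)} _ _ = refl
  owner-up {i = 1F} (s≤s ()) _
  owner-up {i = Fin.suc (Fin.suc _)} {1F} _ (s≤s ())

  owner-toW : ∀ {u} {i : Fin M} → 2 ≤ toℕ i → owner (vtx u i) w ≡ rung-owner u (parity (toℕ i))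
  owner-toW {i = Fin.suc (Fin.suc _)} _ = refl
  owner-toW {i = 1F} (s≤s ())

  owner-fromW : ∀ {u} {i : Fin M} → 2 ≤ toℕ i → owner w (vtx u i) ≡ rung-owner u (parity (toℕ i))
  owner-fromW {i = Fin.suc (Fin.suc _)} _ = refl
  owner-fromW {i = 1F} (s≤s ())

  record Zigzag (ℓ : Label) : Set where
    field
      column : Parity → Fin N
      column-adj : ∀ p → PathAdj (column (p ⁻¹)) (column p)
      column-owner : ∀ p → rung-owner (column p) p ≡ just ℓ

  below-top : ∀ {h d} → suc (h + d) ≡ M → h < M
  below-top {h} {d} eq = ≤-trans (s≤s (m≤m+n h d)) (≤-reflexive eq)

  module _ {ℓ} (z : Zigzag ℓ) where
    open Zigzag z

    rung : (h : ℕ) → .(h < M) → Vertex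
    rung h h<M = vtx (column (parity h)) (fromℕ< h<M)

    rung-step : ∀ h → PathAdj (column (parity h)) (column (parity (suc h)))
    rung-step h =
      subst (λ p → PathAdj (column p) (column (parity (suc h)))) (suc-homo-⁻¹ h) (column-adj (parity (suc h)))

    ascent : ∀ h d (eq : suc (h + d) ≡ M) → Walk G (rung h (below-top eq)) w
    ascent h zero eq =
      toW (trans (cong suc (trans (toℕ-fromℕ< (below-top eq)) (sym (+-identityʳ h)))) eq) ∷ []
    ascent h (suc d) eq =
      up (rung-step h) (trans (cong suc (toℕ-fromℕ< (below-top eq))) (sym (toℕ-fromℕ< (below-top eq′)))) ∷
      ascent (suc h) d eq′
      where
        eq′ : suc (suc h + d) ≡ M
        eq′ = trans (cong suc (sym (+-suc h d))) eq

    rung-level : ∀ {h} .(h<M : h < M) → 2 ≤ h → 2 ≤ toℕ (fromℕ< h<M)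
    rung-level h<M 2≤h = subst (2 ≤_) (sym (toℕ-fromℕ< h<M)) 2≤h

    rung-owned : ∀ h .(h<M : h < M) → rung-owner (column (parity h)) (parity (toℕ (fromℕ< h<M))) ≡ just ℓ
    rung-owned h h<M rewrite toℕ-fromℕ< h<M = column-owner (parity h)

    ascent-labelled : ∀ {h d} (eq : suc (h + d) ≡ M) → 2 ≤ h → Labelled ℓ (ascent h d eq)
    ascent-labelled {h} {zero} eq 2≤h =
      Labelled-∷ (trans (owner-toW 2≤i) (rung-owned h (below-top eq)))
                 (trans (owner-fromW 2≤i) (rung-owned h (below-top eq)))
                 Labelled-[]
      where 2≤i = rung-level (below-top eq) 2≤h
    ascent-labelled {h} {suc d} eq 2≤h =
      Labelled-∷ (trans (owner-up 2≤i 2≤i′) (rung-owned h (below-top eq)))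
        (trans (owner-up 2≤i′ 2≤i) (rung-owned (suc h) (below-top eq′)))
        (ascent-labelled eq′ 2≤1+h)
      where
        eq′ = trans (cong suc (sym (+-suc h d))) eq
        2≤1+h = ≤-trans 2≤h (n≤1+n h)
        2≤i = rung-level (below-top eq) 2≤h
        2≤i′ = rung-level (below-top eq′) 2≤1+h

  zigzag : ∀ (ℓ : Label) (even odd : Fin N) → PathAdj odd even → PathAdj even odd →
           rung-owner even 0ℙ ≡ just ℓ → rung-owner odd 1ℙ ≡ just ℓ → Zigzag ℓ
  zigzag ℓ even odd odd~even even~odd even-owner odd-owner = record
    { column = λ { 0ℙ → even ; 1ℙ → odd }
    ; column-adj = λ { 0ℙ → odd~even ; 1ℙ → even~odd }
    ; column-owner = λ { 0ℙ → even-owner ; 1ℙ → odd-owner }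
    }

  through-apex : ∀ {ℓ} (z z′ : Zigzag ℓ) → Walk G (vtx (Zigzag.column z 0ℙ) 2F) (vtx (Zigzag.column z′ 0ℙ) 2F)
  through-apex z z′ = ascent z 2 k refl ++ʷ reverse (μ-sym P-sym) (ascent z′ 2 k refl)

  through-apex-labelled : ∀ {ℓ} (z z′ : Zigzag ℓ) → Labelled ℓ (through-apex z z′)
  through-apex-labelled z z′ =
    Labelled-++ (ascent-labelled z refl 2≤2)
                (Labelled-⊆ᵉ (reverse-⊆ᵉ (μ-sym P-sym) _) (ascent-labelled z′ refl 2≤2))
    where 2≤2 = s≤s (s≤s z≤n)

  zigzag₀₄ zigzag₄₀ : Zigzag (0F , 4F)
  zigzag₀₄ = zigzag _ 1F 0F (fwd refl) (bwd refl) refl refl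
  zigzag₄₀ = zigzag _ 4F 3F (fwd refl) (bwd refl) refl refl

  zigzag₁₃ zigzag₃₁ : Zigzag (1F , 3F)
  zigzag₁₃ = zigzag _ 0F 1F (bwd refl) (fwd refl) refl refl
  zigzag₃₁ = zigzag _ 3F 4F (bwd refl) (fwd refl) refl refl

  route₀₄ : Walk G (branch 0F) (branch 4F)
  route₀₄ = ramp₀₄ ++ʷ through-apex zigzag₀₄ zigzag₄₀ ++ʷ ramp₄₀

  route₁₃ : Walk G (branch 1F) (branch 3F)
  route₁₃ = ramp₁₃ ++ʷ through-apex zigzag₁₃ zigzag₃₁ ++ʷ ramp₃₁

  route : ∀ i j → i Fin.< j → Σ[ p ∈ Walk G (branch i) (branch j) ] Labelled (i , j) p
  route 0F 1F _ = route₀₁ , Labelled-∷ refl refl (Labelled-∷ refl refl Labelled-[])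
  route 0F 2F _ = route₀₂ , Labelled-∷ refl refl Labelled-[]
  route 0F 3F _ = route₀₃ , Labelled-∷ refl refl (Labelled-∷ refl refl Labelled-[])
  route 0F 4F _ = route₀₄ , Labelled-++ (Labelled-∷ refl refl (Labelled-∷ refl refl Labelled-[]))
                              (Labelled-++ (through-apex-labelled _ _) (Labelled-∷ refl refl Labelled-[]))
  route 1F 2F _ = route₁₂ , Labelled-∷ refl refl Labelled-[]
  route 1F 3F _ = route₁₃ , Labelled-++ (Labelled-∷ refl refl Labelled-[])
                              (Labelled-++ (through-apex-labelled _ _)
                                           (Labelled-∷ refl refl (Labelled-∷ refl refl Labelled-[])))
  route 1F 4F _ = route₁₄ , Labelled-∷ refl refl (Labelled-∷ refl refl Labelled-[])
  route 2F 3F _ = route₂₃ , Labelled-∷ refl refl Labelled-[]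
  route 2F 4F _ = route₂₄ , Labelled-∷ refl refl Labelled-[]
  route 3F 4F _ = route₃₄ , Labelled-∷ refl refl (Labelled-∷ refl refl Labelled-[])
  route _ 0F ()
  route (Fin.suc _) 1F (s≤s ())
  route (Fin.suc (Fin.suc _)) 2F (s≤s (s≤s ()))
  route (Fin.suc (Fin.suc (Fin.suc _))) 3F (s≤s (s≤s (s≤s ())))
  route (Fin.suc (Fin.suc (Fin.suc (Fin.suc _)))) 4F (s≤s (s≤s (s≤s (s≤s ()))))

  K₅-immersion : Immersion G 5
  K₅-immersion = record
    { φ = branch
    ; φ-inj = branch-injective
    ; path = λ i j i<j → proj₁ (shortened i j i<j)
    ; path-isPath = λ i j i<j → proj₁ (proj₂ (shortened i j i<j))
    ; edge-disjoint = λ i j k l i<j k<l a b u v →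
        let ij≡kl = just-injective (trans (sym (path-labelled i j i<j u)) (path-labelled k l k<l v))
        in ,-injectiveˡ ij≡kl , ,-injectiveʳ ij≡kl
    }
    where
      shortened : ∀ i j (i<j : i Fin.< j) → _
      shortened i j i<j = walk⇒path _≟_ (proj₁ (route i j i<j))
      path-labelled : ∀ i j (i<j : i Fin.< j) → Labelled (i , j) (proj₁ (shortened i j i<j))
      path-labelled i j i<j = Labelled-⊆ᵉ (proj₂ (proj₂ (shortened i j i<j))) (proj₂ (route i j i<j))

corollary1 : (m n : ℕ) → m ≥ 3 → n ≥ 5 → ImNumberIs (μ m (P n)) 5
corollary1 (suc (suc (suc k))) (suc (suc (suc (suc (suc l)))))
           (s≤s (s≤s (s≤s _))) (s≤s (s≤s (s≤s (s≤s (s≤s _))))) =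
  Construction.K₅-immersion k l , λ _ → μP-immersion-size
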